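{- The category $\mathrm{LO}^{\mathrm{cond}}$ does not admit modality elimination. Indeed, the modal sentence $\mathrm{Scatt}:=\neg\Diamond\mathrm{Dense}$, where $\mathrm{Dense}$ is the first-order sentence $\exists \ell\exists r\bigl(\ell<r\wedge\forall x(\ell\le x)\wedge\forall x(x\le r)\wedge\forall x\forall y(x<y\to\exists z(x<z\wedge z<y))\bigr)$, is not equivalent in $\mathrm{LO}^{\mathrm{cond}}$ to any first-order $\mathcal L_{\le}$-sentence.
   Context: $\mathcal L_{\le}=\{\le\}$ and $\mathcal L^{\Diamond}_{\le}$ is its extension by modal operators $\Diamond,\Box$. A condensation is a surjective monotone map between nonempty linear orders; $\mathrm{LO}^{\mathrm{cond}}$ is the category of nonempty linear orders and condensations. Modal satisfaction: $U\models\Diamond\varphi[\nu]$ iff there is a condensation $f:U\to V$ with $V\models\varphi[f\circ\nu]$; $\Box$ dually. A category admits modality elimination if every modal formula is equivalent in it (at every world under every valuation) to a modality-free formula. -}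

module Defs where

open import Level using (Level; Lift; lift; 0ℓ) renaming (suc to lsuc)
open import Data.Nat using (ℕ; zero; suc)
open import Data.Fin using (Fin; zero; suc)
open import Data.Product using (Σ; _×_; _,_)
open import Data.Sum using (_⊎_)
open import Data.Empty using (⊥)
open import Data.Unit using (⊤)
open import Relation.Nullary using (¬_)
open import Relation.Binary.PropositionalEquality using (_≡_)
open import Relation.Binary.Structures using (IsTotalOrder)

record LO : Set₁ where
  field
    Carrier      : Set
    _≤_          : Carrier → Carrier → Set
    isTotalOrder : IsTotalOrder _≡_ _≤_
    point        : Carrier          -- nonemptiness

open LO public

record Cond (U V : LO) : Set where
  field
    map        : Carrier U → Carrier V
    monotone   : ∀ {x y} → _≤_ U x y → _≤_ V (map x) (map y)
    surjective : ∀ (v : Carrier V) → Σ (Carrier U) (λ u → map u ≡ v)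

open Cond public

-- Modal L_≤ formulas with n free variables (de Bruijn, Fin n)

data Formula (n : ℕ) : Set where
  _≤'_ _≐_   : Fin n → Fin n → Formula n
  ⊤' ⊥'      : Formula n
  ¬'_        : Formula n → Formula n
  _∧'_ _∨'_ _⇒'_ : Formula n → Formula n → Formula n
  ∃'_ ∀'_    : Formula (suc n) → Formula n
  ◇_ □_      : Formula n → Formula n

infix  7 _≤'_ _≐_
infixr 6 ¬'_ ◇_ □_
infixr 5 _∧'_
infixr 4 _∨'_
infixr 3 _⇒'_
infixr 2 ∃'_ ∀'_

data ModalFree {n : ℕ} : Formula n → Set where
  mf≤  : ∀ i j → ModalFree (i ≤' j)
  mf≐  : ∀ i j → ModalFree (i ≐ j)
  mf⊤  : ModalFree ⊤'
  mf⊥  : ModalFree ⊥'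
  mf¬  : ∀ {φ} → ModalFree φ → ModalFree (¬' φ)
  mf∧  : ∀ {φ ψ} → ModalFree φ → ModalFree ψ → ModalFree (φ ∧' ψ)
  mf∨  : ∀ {φ ψ} → ModalFree φ → ModalFree ψ → ModalFree (φ ∨' ψ)
  mf⇒  : ∀ {φ ψ} → ModalFree φ → ModalFree ψ → ModalFree (φ ⇒' ψ)
  mf∃  : ∀ {φ} → ModalFree φ → ModalFree (∃' φ)
  mf∀  : ∀ {φ} → ModalFree φ → ModalFree (∀' φ)

_▸_ : ∀ {A : Set} {n} → (Fin n → A) → A → Fin (suc n) → A
(ν ▸ a) zero    = a
(ν ▸ a) (suc i) = ν i

Sat : ∀ {n} (U : LO) → Formula n → (Fin n → Carrier U) → Set₁
Sat U (i ≤' j) ν = Lift (lsuc 0ℓ) (_≤_ U (ν i) (ν j))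
Sat U (i ≐ j)  ν = Lift (lsuc 0ℓ) (ν i ≡ ν j)
Sat U ⊤'       ν = Lift (lsuc 0ℓ) ⊤
Sat U ⊥'       ν = Lift (lsuc 0ℓ) ⊥
Sat U (¬' φ)   ν = ¬ Sat U φ ν
Sat U (φ ∧' ψ) ν = Sat U φ ν × Sat U ψ ν
Sat U (φ ∨' ψ) ν = Sat U φ ν ⊎ Sat U ψ ν
Sat U (φ ⇒' ψ) ν = Sat U φ ν → Sat U ψ ν
Sat U (∃' φ)   ν = Σ (Carrier U) (λ a → Sat U φ (ν ▸ a))
Sat U (∀' φ)   ν = (a : Carrier U) → Sat U φ (ν ▸ a)
Sat U (◇ φ)    ν = Σ LO (λ V → Σ (Cond U V) (λ f → Sat V φ (λ i → map f (ν i))))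
Sat U (□ φ)    ν = (V : LO) (f : Cond U V) → Sat V φ (λ i → map f (ν i))

noVal : ∀ {A : Set} → Fin 0 → A
noVal ()

_⊨_ : LO → Formula 0 → Set₁
U ⊨ φ = Sat U φ noVal

_<'_ : ∀ {n} → Fin n → Fin n → Formula n
i <' j = (i ≤' j) ∧' ¬' (i ≐ j)

-- Dense := ∃ℓ ∃r (ℓ<r ∧ ∀x(ℓ≤x) ∧ ∀x(x≤r) ∧ ∀x∀y(x<y → ∃z(x<z ∧ z<y)))
-- de Bruijn: under ∃ℓ ∃r, r = 0, ℓ = 1.
Dense : Formula 0
Dense =
  ∃' ∃' ( (suc zero <' zero)
        ∧' (∀' (suc (suc zero) ≤' zero))
        ∧' (∀' (zero ≤' suc zero))
        ∧' (∀' ∀' ((suc zero <' zero) ⇒'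
               (∃' ((suc (suc zero) <' zero) ∧' (zero <' suc zero))))) )

Scatt : Formula 0
Scatt = ¬' (◇ Dense)

-- ℤ (as ℤ·𝟙) is scattered: under a monotone surjection from ℤ onto a dense order nothing lies strictly
-- between the images of two consecutive integers, so these images coincide and the map is constant.
-- ℤ·ℚ±, one copy of ℤ for every point of 1 + ℚ + 1, is not scattered: collapsing every copy to a point
-- condenses it onto ℚ±, which is dense with endpoints.  Nevertheless ℤ·L₁ and ℤ·L₂ satisfy the same
-- first-order sentences.  In the n-round Ehrenfeucht–Fraïssé game Duplicator keeps the chosen points in
-- the same order and with the same offsets inside a copy of ℤ, as long as these are at most 2ⁿ - 1.
-- A move within 2ⁿ⁻¹ - 1 of an old point is answered by the same shift of that point's partner; any
-- other move is answered 2ⁿ⁻¹ steps above the partner of the greatest old point below it (or below the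
-- partner of the least old point), which the invariant keeps far from all old points.

{-# OPTIONS --safe #-}
module Submission where

open import Level using (Lift; lift; lower; 0ℓ) renaming (suc to lsuc)
open import Axiom.ExcludedMiddle using (ExcludedMiddle)
open import Data.Empty using (⊥-elim)
open import Data.Fin using (Fin; zero; suc)
open import Data.Integer as ℤ using (ℤ; +_; -[1+_]; ∣_∣; _+_; -_; _-_; 0ℤ; 1ℤ)
import Data.Integer.Properties as ℤ
open import Algebra.Properties.AbelianGroup ℤ.+-0-abelianGroup using (∙-cancelˡ)
open import Data.Integer.Tactic.RingSolver using (solve-∀)
open import Data.Nat as ℕ using (ℕ)
import Data.Nat.Properties as ℕ
open import Data.Product using (Σ; Σ-syntax; _×_; _,_; proj₁; proj₂)
open import Data.Product.Function.NonDependent.Propositional using (_×-⇔_)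
open import Data.Product.Relation.Binary.Lex.NonStrict using (×-Lex; ×-isTotalOrder)
open import Data.Product.Relation.Binary.Pointwise.NonDependent using (Pointwise; ≡⇒≡×≡; ≡×≡⇒≡)
open import Data.Rational as ℚ using (ℚ; 0ℚ; 1ℚ)
import Data.Rational.Properties as ℚ
open import Data.Sum using (_⊎_; inj₁; inj₂; [_,_]′)
open import Data.Sum.Function.Propositional using (_⊎-⇔_)
open import Data.Unit using (⊤; tt)
import Data.Unit.Properties as ⊤
open import Function using (_∘_)
open import Function.Bundles using (_⇔_; mk⇔; Equivalence)
import Function.Properties.Equivalence as ⇔
open import Function.Related.TypeIsomorphisms using (→-cong-⇔; ¬-cong-⇔)
open import Relation.Binary using (Rel; IsTotalOrder; IsTotalPreorder)
import Relation.Binary.Construct.Flip.EqAndOrd as Flip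
import Relation.Binary.Construct.NonStrictToStrict as Strict
open import Relation.Binary.PropositionalEquality
  using (_≡_; _≢_; refl; sym; trans; cong; subst; subst₂; isEquivalence; module ≡-Reasoning)
open import Relation.Nullary using (¬_; yes; no)
open import Relation.Nullary.Decidable using (map′)
open import Relation.Nullary.Construct.Add.Extrema using (_±; ⊥±; ⊤±; [_]; [_]-injective)
open import Relation.Binary.Construct.Add.Extrema.NonStrict ℚ._≤_
  using (_≤±_; ⊥±≤_; _≤⊤±; ≤±-isTotalOrder-≡; ⊥±≤⊥±; ⊥±≤[_]; ⊥±≤⊤±; [_]≤⊤±; ⊤±≤⊤±)
  renaming ([_] to [≤_])
open import Relation.Unary using (Pred; Decidable)

open import Defs

open Equivalence using (to; from)

lower-em : ExcludedMiddle (lsuc 0ℓ) → ExcludedMiddle 0ℓ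
lower-em em = map′ lower lift em

Lift-cong-⇔ : ∀ {a b ℓ} {A : Set a} {B : Set b} → A ⇔ B → Lift ℓ A ⇔ Lift ℓ B
Lift-cong-⇔ A⇔B = mk⇔ (λ (lift x) → lift (to A⇔B x)) (λ (lift y) → lift (from A⇔B y))

j≡i+[j-i] : ∀ i j → j ≡ i + (j - i)
j≡i+[j-i] = solve-∀

+-cancelˡ-≤ : ∀ i {j k} → i + j ℤ.≤ i + k → j ℤ.≤ k
+-cancelˡ-≤ i {j} {k} le = subst₂ ℤ._≤_ (-i+[i+j]≡j i j) (-i+[i+j]≡j i k) (ℤ.+-monoʳ-≤ (- i) le)
  where
  -i+[i+j]≡j : ∀ i j → - i + (i + j) ≡ j
  -i+[i+j]≡j = solve-∀

∣i∣≤n⇒i≤n : ∀ {i n} → ∣ i ∣ ℕ.≤ n → i ℤ.≤ + n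
∣i∣≤n⇒i≤n {+ _}       ∣i∣≤n = ℤ.+≤+ ∣i∣≤n
∣i∣≤n⇒i≤n { -[1+ _ ]} _     = ℤ.-≤+

∣i∣≤n⇒1+n≰i : ∀ {i n} → ∣ i ∣ ℕ.≤ n → ¬ (+ ℕ.suc n ℤ.≤ i)
∣i∣≤n⇒1+n≰i ∣i∣≤n 1+n≤i = ℕ.1+n≰n (ℤ.drop‿+≤+ (ℤ.≤-trans 1+n≤i (∣i∣≤n⇒i≤n ∣i∣≤n)))

far-≤ : ∀ {n s z} → n ℕ.< ∣ s ∣ → ∣ z ∣ ℕ.≤ n → z ℤ.≤ s ⇔ 0ℤ ℤ.≤ s
far-≤ {s = + _}      {+ _}       n<s ∣z∣≤n =
  mk⇔ (λ _ → ℤ.+≤+ ℕ.z≤n) (λ _ → ℤ.+≤+ (ℕ.≤-trans ∣z∣≤n (ℕ.<⇒≤ n<s)))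
far-≤ {s = + _}      { -[1+ _ ]} _   _     = mk⇔ (λ _ → ℤ.+≤+ ℕ.z≤n) (λ _ → ℤ.-≤+)
far-≤ {s = -[1+ _ ]} {+ _}       _   _     = mk⇔ (λ ()) (λ ())
far-≤ {s = -[1+ _ ]} { -[1+ _ ]} n<s ∣z∣≤n =
  mk⇔ (λ { (ℤ.-≤- s≤z) → ⊥-elim (ℕ.<⇒≱ n<s (ℕ.≤-trans (ℕ.s≤s s≤z) ∣z∣≤n)) }) (λ ())

m+n≤1+o+o⇒m≤o⊎n≤o : ∀ {m n o} → m ℕ.+ n ℕ.≤ ℕ.suc (o ℕ.+ o) → m ℕ.≤ o ⊎ n ℕ.≤ o
m+n≤1+o+o⇒m≤o⊎n≤o {m} {n} {o} le with m ℕ.≤? o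
... | yes m≤o = inj₁ m≤o
... | no  m≰o = inj₂ (ℕ.+-cancelˡ-≤ (ℕ.suc o) n o (ℕ.≤-trans (ℕ.+-monoˡ-≤ n (ℕ.≰⇒> m≰o)) le))

∣i+j∣≤1+n+n⇒∣i∣≤n⊎∣j∣≤n : ∀ {i j n} → 0ℤ ℤ.≤ i → 0ℤ ℤ.≤ j → ∣ i + j ∣ ℕ.≤ ℕ.suc (n ℕ.+ n) →
                           ∣ i ∣ ℕ.≤ n ⊎ ∣ j ∣ ℕ.≤ n
∣i+j∣≤1+n+n⇒∣i∣≤n⊎∣j∣≤n (ℤ.+≤+ _) (ℤ.+≤+ _) = m+n≤1+o+o⇒m≤o⊎n≤o

offset : ∀ {i j} → i ℤ.≤ j → Σ[ d ∈ ℕ ] j ≡ i + + d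
offset {i} {j} i≤j = ∣ j - i ∣ , (begin
  j                  ≡⟨ j≡i+[j-i] i j ⟩
  i + (j - i)        ≡⟨ cong (_+_ i) (ℤ.0≤i⇒+∣i∣≡i (ℤ.i≤j⇒0≤j-i i≤j)) ⟨
  i + + ∣ j - i ∣    ∎)
  where open ≡-Reasoning

module _ {A : Set} (f : ℤ → A) (suc-invariant : ∀ i → f (ℤ.suc i) ≡ f i) where

  suc-invariant-upward : ∀ i d → f (i + + d) ≡ f i
  suc-invariant-upward i ℕ.zero    = cong f (ℤ.+-identityʳ i)
  suc-invariant-upward i (ℕ.suc d) = begin
    f (i + + ℕ.suc d)   ≡⟨ cong f (i+[1+j]≡1+[i+j] i (+ d)) ⟩
    f (ℤ.suc (i + + d)) ≡⟨ suc-invariant (i + + d) ⟩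
    f (i + + d)         ≡⟨ suc-invariant-upward i d ⟩
    f i                 ∎
    where
    open ≡-Reasoning
    i+[1+j]≡1+[i+j] : ∀ i j → i + (1ℤ + j) ≡ 1ℤ + (i + j)
    i+[1+j]≡1+[i+j] = solve-∀

  suc-invariant⇒constant : ∀ i j → f i ≡ f j
  suc-invariant⇒constant i j with ℤ.≤-total i j
  ... | inj₁ i≤j = let d , j≡i+d = offset i≤j in sym (trans (cong f j≡i+d) (suc-invariant-upward i d))
  ... | inj₂ j≤i = let d , i≡j+d = offset j≤i in trans (cong f i≡j+d) (suc-invariant-upward j d)

infix 4 ≤⟨⟩-syntax <⟨⟩-syntax

≤⟨⟩-syntax : (U : LO) → Carrier U → Carrier U → Set
≤⟨⟩-syntax = _≤_
syntax ≤⟨⟩-syntax U x y = x ≤⟨ U ⟩ y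

<⟨⟩-syntax : (U : LO) → Carrier U → Carrier U → Set
<⟨⟩-syntax U = Strict._<_ _≡_ (_≤_ U)
syntax <⟨⟩-syntax U x y = x <⟨ U ⟩ y

isTotalOrder-≡ : ∀ {A B : Set} {_≤_ : Rel (A × B) 0ℓ} →
                 IsTotalOrder (Pointwise _≡_ _≡_) _≤_ → IsTotalOrder _≡_ _≤_
isTotalOrder-≡ o = record
  { isPartialOrder = record
    { isPreorder = record { isEquivalence = isEquivalence ; reflexive = O.reflexive ∘ ≡⇒≡×≡ ; trans = O.trans }
    ; antisym    = λ x≤y y≤x → ≡×≡⇒≡ (O.antisym x≤y y≤x) }
  ; total = O.total }
  where module O = IsTotalOrder o

module _ {A : Set} {_≈_ _≼_ : Rel A 0ℓ} (≼-isTotalPreorder : IsTotalPreorder _≈_ _≼_) where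
  open IsTotalPreorder ≼-isTotalPreorder using () renaming (refl to ≼-refl; trans to ≼-trans; total to ≼-total)

  greatest : ∀ {m} (a : Fin m → A) {P : Pred (Fin m) 0ℓ} → Decidable P →
             (∀ i → ¬ P i) ⊎ Σ[ i ∈ Fin m ] P i × (∀ j → P j → a j ≼ a i)
  greatest {ℕ.zero}  a P? = inj₁ (λ ())
  greatest {ℕ.suc m} a P? with greatest (a ∘ suc) (P? ∘ suc) | P? zero
  ... | inj₁ none | no ¬P0 = inj₁ λ { zero P0 → ¬P0 P0 ; (suc j) Pj → none j Pj }
  ... | inj₁ none | yes P0 = inj₂ (zero , P0 , λ { zero _ → ≼-refl ; (suc j) Pj → ⊥-elim (none j Pj) })
  ... | inj₂ (i , Pi , max) | no ¬P0 = inj₂ (suc i , Pi , λ { zero P0 → ⊥-elim (¬P0 P0) ; (suc j) Pj → max j Pj })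
  ... | inj₂ (i , Pi , max) | yes P0 with ≼-total (a zero) (a (suc i))
  ...   | inj₁ a0≼ai = inj₂ (suc i , Pi , λ { zero _ → a0≼ai ; (suc j) Pj → max j Pj })
  ...   | inj₂ ai≼a0 = inj₂ (zero , P0 , λ { zero _ → ≼-refl ; (suc j) Pj → ≼-trans (max j Pj) ai≼a0 })

record BoundedDense (U : LO) : Set where
  field
    bottom top   : Carrier U
    bottom<top   : bottom <⟨ U ⟩ top
    bottom-least : ∀ x → bottom ≤⟨ U ⟩ x
    top-greatest : ∀ x → x ≤⟨ U ⟩ top
    dense        : ∀ {x y} → x <⟨ U ⟩ y → Σ[ z ∈ Carrier U ] x <⟨ U ⟩ z × z <⟨ U ⟩ y

⊨Dense⇔BoundedDense : ∀ {U} → U ⊨ Dense ⇔ BoundedDense U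
⊨Dense⇔BoundedDense {U} = mk⇔ toBD fromBD
  where
  sat-< : ∀ {x y} → (Lift (lsuc 0ℓ) (x ≤⟨ U ⟩ y) × ¬ Lift (lsuc 0ℓ) (x ≡ y)) ⇔ x <⟨ U ⟩ y
  sat-< = mk⇔ (λ (lift x≤y , x≢y) → x≤y , x≢y ∘ lift) (λ (x≤y , x≢y) → lift x≤y , x≢y ∘ lower)
  toBD : U ⊨ Dense → BoundedDense U
  toBD (ℓ , r , ℓ<r , ℓ≤ , ≤r , dense) = record
    { bottom = ℓ ; top = r ; bottom<top = to sat-< ℓ<r
    ; bottom-least = lower ∘ ℓ≤ ; top-greatest = lower ∘ ≤r
    ; dense = λ x<y → let z , x<z , z<y = dense _ _ (from sat-< x<y) in z , to sat-< x<z , to sat-< z<y }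
  fromBD : BoundedDense U → U ⊨ Dense
  fromBD d = bottom , top , from sat-< bottom<top , lift ∘ bottom-least , lift ∘ top-greatest ,
             λ x y x<y → let z , x<z , z<y = dense (to sat-< x<y) in z , from sat-< x<z , from sat-< z<y
    where open BoundedDense d

𝟙 : LO
𝟙 = record { Carrier = ⊤ ; _≤_ = _≡_ ; isTotalOrder = ⊤.≡-isTotalOrder ; point = tt }

ℚ± : LO
ℚ± = record { Carrier = ℚ ± ; _≤_ = _≤±_ ; isTotalOrder = ≤±-isTotalOrder-≡ ℚ.≤-isTotalOrder ; point = ⊥± }

ℚ±-boundedDense : BoundedDense ℚ±
ℚ±-boundedDense = record
  { bottom = ⊥± ; top = ⊤± ; bottom<top = ⊥±≤⊤± , λ ()
  ; bottom-least = ⊥±≤_ ; top-greatest = _≤⊤± ; dense = dense }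
  where
  [<] : ∀ {p q} → p ℚ.< q → [ p ] <⟨ ℚ± ⟩ [ q ]
  [<] p<q = [≤ ℚ.<⇒≤ p<q ] , ℚ.<⇒≢ p<q ∘ [_]-injective
  q-1<q : ∀ q → q ℚ.- 1ℚ ℚ.< q
  q-1<q q = subst (q ℚ.- 1ℚ ℚ.<_) (ℚ.+-identityʳ q) (ℚ.+-monoʳ-< q (ℚ.negative⁻¹ (ℚ.- 1ℚ)))
  q<q+1 : ∀ q → q ℚ.< q ℚ.+ 1ℚ
  q<q+1 q = subst (ℚ._< q ℚ.+ 1ℚ) (ℚ.+-identityʳ q) (ℚ.+-monoʳ-< q (ℚ.positive⁻¹ 1ℚ))
  dense : ∀ {x y} → x <⟨ ℚ± ⟩ y → Σ[ z ∈ ℚ ± ] x <⟨ ℚ± ⟩ z × z <⟨ ℚ± ⟩ y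
  dense (⊥±≤⊥± , x≢y)    = ⊥-elim (x≢y refl)
  dense (⊥±≤[ q ] , _)   = [ q ℚ.- 1ℚ ] , (⊥±≤[ _ ] , λ ()) , [<] (q-1<q q)
  dense (⊥±≤⊤± , _)      = [ 0ℚ ] , (⊥±≤[ _ ] , λ ()) , ([ _ ]≤⊤± , λ ())
  dense ([≤ p≤q ] , p≢q) = let m , p<m , m<q = ℚ.<-dense (ℚ.≰⇒> (p≢q ∘ cong [_] ∘ ℚ.≤-antisym p≤q)) in
                           [ m ] , [<] p<m , [<] m<q
  dense ([ p ]≤⊤± , _)   = [ p ℚ.+ 1ℚ ] , [<] (q<q+1 p) , ([ _ ]≤⊤± , λ ())
  dense (⊤±≤⊤± , x≢y)    = ⊥-elim (x≢y refl)

infixl 6 _⊕_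

_⊕_ : ∀ {C : Set} → C × ℤ → ℤ → C × ℤ
(c , k) ⊕ z = c , k + z

Within : ∀ {C : Set} → ℕ → C × ℤ → C × ℤ → Set
Within N p q = Σ[ z ∈ ℤ ] ∣ z ∣ ℕ.≤ N × q ≡ p ⊕ z

Far : ∀ {C : Set} → ℕ → C × ℤ → C × ℤ → Set
Far N p q = ¬ Within N p q

module _ {C : Set} where

  ⊕-identityʳ : ∀ (p : C × ℤ) → p ⊕ 0ℤ ≡ p
  ⊕-identityʳ (c , k) = cong (c ,_) (ℤ.+-identityʳ k)

  ⊕-assoc : ∀ (p : C × ℤ) z t → p ⊕ z ⊕ t ≡ p ⊕ (z + t)
  ⊕-assoc (c , k) z t = cong (c ,_) (ℤ.+-assoc k z t)

  ⊕-cancelˡ : ∀ (p : C × ℤ) {z t} → p ⊕ z ≡ p ⊕ t → z ≡ t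
  ⊕-cancelˡ (c , k) {z} {t} eq = ∙-cancelˡ k z t (cong proj₂ eq)

  ⊕-difference : ∀ {p q : C × ℤ} → proj₁ p ≡ proj₁ q → q ≡ p ⊕ (proj₂ q - proj₂ p)
  ⊕-difference {c , k} {_ , k'} refl = cong (c ,_) (j≡i+[j-i] k k')

  ⊕-flip : ∀ {p q : C × ℤ} {z} → q ≡ p ⊕ z → p ≡ q ⊕ (- z)
  ⊕-flip {c , k} {z = z} refl = cong (c ,_) (sym (i+j-j≡i k z))
    where
    i+j-j≡i : ∀ i j → i + j - j ≡ i
    i+j-j≡i = solve-∀

  ⊕-flip-⇔ : ∀ {p q : C × ℤ} {z} → q ≡ p ⊕ z ⇔ p ≡ q ⊕ (- z)
  ⊕-flip-⇔ {p} {q} {z} = mk⇔ ⊕-flip (subst (λ w → q ≡ p ⊕ w) (ℤ.neg-involutive z) ∘ ⊕-flip)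

  ≡⊕0⇔≡ : ∀ {p q : C × ℤ} → q ≡ p ⊕ 0ℤ ⇔ q ≡ p
  ≡⊕0⇔≡ {p} = mk⇔ (λ e → trans e (⊕-identityʳ p)) (λ e → trans e (sym (⊕-identityʳ p)))

  ≡⊕⇔≡0 : ∀ {p : C × ℤ} {z} → p ≡ p ⊕ z ⇔ z ≡ 0ℤ
  ≡⊕⇔≡0 {p} = mk⇔ (λ e → sym (⊕-cancelˡ p (trans (⊕-identityʳ p) e))) (λ { refl → sym (⊕-identityʳ p) })

  within-sym : ∀ {N} {p q : C × ℤ} → Within N p q → Within N q p
  within-sym {N} (z , ∣z∣≤N , q≡p⊕z) = - z , subst (ℕ._≤ N) (sym (ℤ.∣-i∣≡∣i∣ z)) ∣z∣≤N , ⊕-flip q≡p⊕z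

  far-sym : ∀ {N} {p q : C × ℤ} → Far N p q → Far N q p
  far-sym far = far ∘ within-sym

rank : ∀ {n} {φ : Formula n} → ModalFree φ → ℕ
rank (mf≤ _ _) = 0
rank (mf≐ _ _) = 0
rank mf⊤       = 0
rank mf⊥       = 0
rank (mf¬ φ)   = rank φ
rank (mf∧ φ ψ) = rank φ ℕ.⊔ rank ψ
rank (mf∨ φ ψ) = rank φ ℕ.⊔ rank ψ
rank (mf⇒ φ ψ) = rank φ ℕ.⊔ rank ψ
rank (mf∃ φ)   = ℕ.suc (rank φ)
rank (mf∀ φ)   = ℕ.suc (rank φ)

-- scale n = 2ⁿ - 1, the largest offset that n more rounds of the game must respect.
scale : ℕ → ℕ
scale ℕ.zero    = 0
scale (ℕ.suc n) = ℕ.suc (scale n ℕ.+ scale n)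

module Classical (em : ExcludedMiddle 0ℓ) where

  ≤-flip : ∀ (U : LO) {x y} → y ≤⟨ U ⟩ x ⇔ (y ≡ x ⊎ ¬ x ≤⟨ U ⟩ y)
  ≤-flip U {x} {y} = mk⇔ forward backward
    where
    open IsTotalOrder (isTotalOrder U) using (antisym; reflexive; total)
    forward : y ≤⟨ U ⟩ x → y ≡ x ⊎ ¬ x ≤⟨ U ⟩ y
    forward y≤x with em {y ≡ x}
    ... | yes y≡x = inj₁ y≡x
    ... | no  y≢x = inj₂ (λ x≤y → y≢x (antisym y≤x x≤y))
    backward : y ≡ x ⊎ ¬ x ≤⟨ U ⟩ y → y ≤⟨ U ⟩ x
    backward (inj₁ y≡x) = reflexive y≡x
    backward (inj₂ x≰y) with total x y
    ... | inj₁ x≤y = ⊥-elim (x≰y x≤y)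
    ... | inj₂ y≤x = y≤x

  module _ {V : LO} (g : ℤ → Carrier V) (g-mono : ∀ {i j} → i ℤ.≤ j → g i ≤⟨ V ⟩ g j)
           (g-surj : ∀ v → Σ[ i ∈ ℤ ] g i ≡ v) where
    open IsTotalOrder (isTotalOrder V) using (antisym)

    nothing-between : ∀ c {v} → g c ≤⟨ V ⟩ v → v ≤⟨ V ⟩ g (ℤ.suc c) → v ≡ g c ⊎ v ≡ g (ℤ.suc c)
    nothing-between c {v} gc≤v v≤gc+1 with g-surj v
    ... | w , refl with w ℤ.≤? c
    ...   | yes w≤c = inj₁ (antisym (g-mono w≤c) gc≤v)
    ...   | no  w≰c = inj₂ (antisym v≤gc+1 (g-mono (ℤ.i<j⇒suc[i]≤j (ℤ.≰⇒> w≰c))))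

    dense⇒constant : (∀ {x y} → x <⟨ V ⟩ y → Σ[ z ∈ Carrier V ] x <⟨ V ⟩ z × z <⟨ V ⟩ y) → ∀ i j → g i ≡ g j
    dense⇒constant dense = suc-invariant⇒constant g step
      where
      step : ∀ c → g (ℤ.suc c) ≡ g c
      step c with em {g c ≡ g (ℤ.suc c)}
      ... | yes gc≡gc+1 = sym gc≡gc+1
      ... | no  gc≢gc+1 =
        let z , (gc≤z , gc≢z) , (z≤gc+1 , z≢gc+1) = dense (g-mono (ℤ.i≤suc[i] c) , gc≢gc+1) in
        ⊥-elim ([ gc≢z ∘ sym , z≢gc+1 ]′ (nothing-between c gc≤z z≤gc+1))

    image-not-boundedDense : ¬ BoundedDense V
    image-not-boundedDense bd = proj₂ bottom<top (begin
      bottom ≡⟨ proj₂ (g-surj bottom) ⟨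
      g _    ≡⟨ dense⇒constant dense _ _ ⟩
      g _    ≡⟨ proj₂ (g-surj top) ⟩
      top    ∎)
      where
      open BoundedDense bd
      open ≡-Reasoning

  infix 25 ℤ·_

  ℤ·_ : LO → LO
  ℤ· L = record
    { Carrier      = Carrier L × ℤ
    ; _≤_          = ×-Lex _≡_ (_≤_ L) ℤ._≤_
    ; isTotalOrder = isTotalOrder-≡ (×-isTotalOrder (λ _ _ → em) (isTotalOrder L) ℤ.≤-isTotalOrder)
    ; point        = point L , 0ℤ
    }

  module Copies (L : LO) where

    Point : Set
    Point = Carrier (ℤ· L)

    infix 4 _≼_
    _≼_ : Point → Point → Set
    p ≼ q = p ≤⟨ ℤ· L ⟩ q

    open IsTotalOrder (isTotalOrder (ℤ· L)) public
      using () renaming (isTotalPreorder to ≼-isTotalPreorder; antisym to ≼-antisym; trans to ≼-trans)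
    open IsTotalOrder (isTotalOrder L) using (antisym) renaming (reflexive to ≤-reflexive)

    ≼-refl : ∀ {p} → p ≼ p
    ≼-refl = IsTotalOrder.reflexive (isTotalOrder (ℤ· L)) refl

    ≰⇒≽ : ∀ {p q} → ¬ p ≼ q → q ≼ p
    ≰⇒≽ p⋠q with IsTotalOrder.total (isTotalOrder (ℤ· L)) _ _
    ... | inj₁ p≼q = ⊥-elim (p⋠q p≼q)
    ... | inj₂ q≼p = q≼p

    copy-mono : ∀ {p q} → p ≼ q → proj₁ p ≤⟨ L ⟩ proj₁ q
    copy-mono (inj₁ (l≤l' , _)) = l≤l'
    copy-mono (inj₂ (refl , _)) = ≤-reflexive refl

    copy-squeeze : ∀ {p x q} → p ≼ x → x ≼ q → proj₁ p ≡ proj₁ q → proj₁ p ≡ proj₁ x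
    copy-squeeze p≼x x≼q refl = antisym (copy-mono p≼x) (copy-mono x≼q)

    ≼-apart : ∀ {p q} → proj₁ p ≢ proj₁ q → p ≼ q ⇔ proj₁ p <⟨ L ⟩ proj₁ q
    ≼-apart l≢l' = mk⇔ (λ { (inj₁ l<l') → l<l' ; (inj₂ (l≡l' , _)) → ⊥-elim (l≢l' l≡l') }) inj₁

    ⊕-≼-⊕ : ∀ p {z s} → p ⊕ z ≼ p ⊕ s ⇔ z ℤ.≤ s
    ⊕-≼-⊕ (l , k) = mk⇔ (λ { (inj₁ (_ , l≢l)) → ⊥-elim (l≢l refl) ; (inj₂ (_ , le)) → +-cancelˡ-≤ k le })
                        (λ z≤s → inj₂ (refl , ℤ.+-monoʳ-≤ k z≤s))

    ≼-offset : ∀ {p q s z} → q ≡ p ⊕ s → p ⊕ z ≼ q ⇔ z ℤ.≤ s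
    ≼-offset {p} refl = ⊕-≼-⊕ p

    ≼-offsetʳ : ∀ {p q s} → q ≡ p ⊕ s → p ≼ q ⇔ 0ℤ ℤ.≤ s
    ≼-offsetʳ {p} {q} {s} q≡p⊕s = subst (λ r → r ≼ q ⇔ 0ℤ ℤ.≤ s) (⊕-identityʳ p) (≼-offset {p} q≡p⊕s)

    ≼-offsetˡ : ∀ {p q s} → q ≡ p ⊕ s → q ≼ p ⇔ s ℤ.≤ 0ℤ
    ≼-offsetˡ {p} {q} {s} refl = subst (λ r → p ⊕ s ≼ r ⇔ s ℤ.≤ 0ℤ) (⊕-identityʳ p) (⊕-≼-⊕ p)

    data Placement (p : Point) : Point → Set where
      apart : ∀ {q} → proj₁ p ≢ proj₁ q → Placement p q
      along : ∀ s → Placement p (p ⊕ s)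

    placement : ∀ p q → Placement p q
    placement (l , k) (l' , k') with em {l ≡ l'}
    ... | no  l≢l' = apart l≢l'
    ... | yes refl = subst (Placement (l , k)) (sym (⊕-difference {p = l , k} refl)) (along (k' - k))

    ⊕-≼-far : ∀ {M p q z} → Far M p q → ∣ z ∣ ℕ.≤ M → p ⊕ z ≼ q ⇔ p ≼ q
    ⊕-≼-far {p = l , k} {q} far ∣z∣≤M with placement (l , k) q
    ... | apart l≢l' = ⇔.trans (≼-apart l≢l') (⇔.sym (≼-apart l≢l'))
    ... | along s    = ⇔.trans (⊕-≼-⊕ (l , k)) (⇔.trans (far-≤ M<∣s∣ ∣z∣≤M) (⇔.sym (≼-offsetʳ {l , k} refl)))
      where M<∣s∣ = ℕ.≰⇒> (λ ∣s∣≤M → far (s , ∣s∣≤M , refl))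

    above-far : ∀ {N p q} → q ≼ p → ¬ (p ⊕ + ℕ.suc N ≼ q) × Far N q (p ⊕ + ℕ.suc N)
    above-far {N} {p} {q} q≼p = y⋠q , far
      where
      y⋠q : ¬ (p ⊕ + ℕ.suc N ≼ q)
      y⋠q y≼q with to (≼-offsetˡ {p} refl) (≼-trans y≼q q≼p)
      ... | ℤ.+≤+ ()
      far : Far N q (p ⊕ + ℕ.suc N)
      far (t , ∣t∣≤N , y≡q⊕t) = ∣i∣≤n⇒1+n≰i {t} ∣t∣≤N (ℤ.i-j≤0⇒i≤j {+ ℕ.suc N} {t}
        (to (≼-offsetˡ {p} (trans (⊕-flip y≡q⊕t) (⊕-assoc p (+ ℕ.suc N) (- t)))) q≼p))

    below-far : ∀ {N p q} → p ≼ q → p ⊕ -[1+ N ] ≼ q × Far N q (p ⊕ -[1+ N ])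
    below-far {N} {p} {q} p≼q = ≼-trans (from (≼-offsetˡ {p} refl) ℤ.-≤+) p≼q , far
      where
      far : Far N q (p ⊕ -[1+ N ])
      far (t , ∣t∣≤N , y≡q⊕t) = ∣i∣≤n⇒1+n≰i { - t} (subst (ℕ._≤ N) (sym (ℤ.∣-i∣≡∣i∣ t)) ∣t∣≤N)
        (ℤ.neg-mono-≤ (ℤ.0≤i-j⇒j≤i { -[1+ N ]} {t}
          (to (≼-offsetʳ {p} (trans (⊕-flip y≡q⊕t) (⊕-assoc p -[1+ N ] (- t)))) p≼q)))

    between-far : ∀ {N p q} → p ≼ q → Far (ℕ.suc (N ℕ.+ N)) p q →
                  p ⊕ + ℕ.suc N ≼ q × Far N q (p ⊕ + ℕ.suc N)
    between-far {N} {p} {q} p≼q far = from (⊕-≼-far far (ℕ.s≤s (ℕ.m≤m+n N N))) p≼q , far′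
      where
      far′ : Far N q (p ⊕ + ℕ.suc N)
      far′ (t , ∣t∣≤N , y≡q⊕t) = far (+ ℕ.suc N - t ,
        ℕ.≤-trans (ℤ.∣i-j∣≤∣i∣+∣j∣ (+ ℕ.suc N) t) (ℕ.+-monoʳ-≤ (ℕ.suc N) ∣t∣≤N) ,
        trans (⊕-flip y≡q⊕t) (⊕-assoc p (+ ℕ.suc N) (- t)))

    -- x splits the offset from p to q into two non-negative parts, one of which is at most N.
    gap : ∀ {N p x q} → p ≼ x → x ≼ q → Far N p x → Far N x q → Far (ℕ.suc (N ℕ.+ N)) p q
    gap {N} {p@(l , k)} {x} {q} p≼x x≼q far₁ far₂ (s , ∣s∣≤1+N+N , q≡p⊕s) =
      [ (λ ∣u∣≤N → far₁ (u , ∣u∣≤N , x≡p⊕u)) , (λ ∣v∣≤N → far₂ (v , ∣v∣≤N , q≡x⊕v)) ]′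
        (∣i+j∣≤1+n+n⇒∣i∣≤n⊎∣j∣≤n (to (≼-offsetʳ {p} x≡p⊕u) p≼x) (to (≼-offsetʳ {x} q≡x⊕v) x≼q)
                                 (subst (λ w → ∣ w ∣ ℕ.≤ ℕ.suc (N ℕ.+ N)) s≡u+v ∣s∣≤1+N+N))
      where
      q~p : proj₁ q ≡ l
      q~p = cong proj₁ q≡p⊕s
      p~x : l ≡ proj₁ x
      p~x = copy-squeeze p≼x x≼q (sym q~p)
      u = proj₂ x - k
      v = proj₂ q - proj₂ x
      x≡p⊕u : x ≡ p ⊕ u
      x≡p⊕u = ⊕-difference {p = p} p~x
      q≡x⊕v : q ≡ x ⊕ v
      q≡x⊕v = ⊕-difference {p = x} (trans (sym p~x) (sym q~p))
      s≡u+v : s ≡ u + v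
      s≡u+v = ⊕-cancelˡ p (begin
        p ⊕ s        ≡⟨ sym q≡p⊕s ⟩
        q            ≡⟨ q≡x⊕v ⟩
        x ⊕ v        ≡⟨ cong (_⊕ v) x≡p⊕u ⟩
        p ⊕ u ⊕ v    ≡⟨ ⊕-assoc p u v ⟩
        p ⊕ (u + v)  ∎)
        where open ≡-Reasoning

  collapse : ∀ L → Cond (ℤ· L) L
  collapse L = record { map = proj₁ ; monotone = Copies.copy-mono L ; surjective = λ l → (l , 0ℤ) , refl }

  ℤ·𝟙-scattered : ℤ· 𝟙 ⊨ Scatt
  ℤ·𝟙-scattered (V , f , V⊨Dense) =
    image-not-boundedDense {V} (λ k → map f (tt , k)) (λ k≤k' → monotone f (inj₂ (refl , k≤k')))
                           (λ v → proj₂ (proj₁ (surjective f v)) , proj₂ (surjective f v))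
                           (to ⊨Dense⇔BoundedDense V⊨Dense)

  ℤ·ℚ±-unscattered : ¬ (ℤ· ℚ± ⊨ Scatt)
  ℤ·ℚ±-unscattered scattered = scattered (ℚ± , collapse ℚ± , from ⊨Dense⇔BoundedDense ℚ±-boundedDense)

  record Similar (L₁ L₂ : LO) (N : ℕ) (p q : Carrier (ℤ· L₁)) (p' q' : Carrier (ℤ· L₂)) : Set where
    field
      order   : p ≤⟨ ℤ· L₁ ⟩ q ⇔ p' ≤⟨ ℤ· L₂ ⟩ q'
      offsets : ∀ z → ∣ z ∣ ℕ.≤ N → q ≡ p ⊕ z ⇔ q' ≡ p' ⊕ z

    equal : q ≡ p ⇔ q' ≡ p'
    equal = ⇔.trans (⇔.sym ≡⊕0⇔≡) (⇔.trans (offsets 0ℤ ℕ.z≤n) ≡⊕0⇔≡)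

    far : Far N p q → Far N p' q'
    far ¬near (z , ∣z∣≤N , q'≡p'⊕z) = ¬near (z , ∣z∣≤N , from (offsets z ∣z∣≤N) q'≡p'⊕z)

  open Similar

  similar-sym : ∀ {L₁ L₂ N p q p' q'} → Similar L₁ L₂ N p q p' q' → Similar L₂ L₁ N p' q' p q
  similar-sym sim = record { order = ⇔.sym (order sim) ; offsets = λ z ∣z∣≤N → ⇔.sym (offsets sim z ∣z∣≤N) }

  SimilarTuples : (L₁ L₂ : LO) → ℕ → ∀ {m} → (Fin m → Carrier (ℤ· L₁)) → (Fin m → Carrier (ℤ· L₂)) → Set
  SimilarTuples L₁ L₂ N a b = ∀ i j → Similar L₁ L₂ N (a i) (a j) (b i) (b j)

  module Game (L₁ L₂ : LO) where
    private
      module A = Copies L₁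
      module B = Copies L₂

    similar-mono : ∀ {M N p q p' q'} → N ℕ.≤ M → Similar L₁ L₂ M p q p' q' → Similar L₁ L₂ N p q p' q'
    similar-mono N≤M sim = record
      { order = order sim ; offsets = λ z ∣z∣≤N → offsets sim z (ℕ.≤-trans ∣z∣≤N N≤M) }

    similar-refl : ∀ {N p p'} → Similar L₁ L₂ N p p p' p'
    similar-refl = record
      { order   = mk⇔ (λ _ → B.≼-refl) (λ _ → A.≼-refl)
      ; offsets = λ _ _ → ⇔.trans ≡⊕⇔≡0 (⇔.sym ≡⊕⇔≡0) }

    similar-swap : ∀ {N p q p' q'} → Similar L₁ L₂ N p q p' q' → Similar L₁ L₂ N q p q' p'
    similar-swap {N} sim = record
      { order   = ⇔.trans (≤-flip (ℤ· L₁)) (⇔.trans (equal sim ⊎-⇔ ¬-cong-⇔ (order sim)) (⇔.sym (≤-flip (ℤ· L₂))))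
      ; offsets = λ z ∣z∣≤N →
          ⇔.trans ⊕-flip-⇔ (⇔.trans (offsets sim (- z) (subst (ℕ._≤ N) (sym (ℤ.∣-i∣≡∣i∣ z)) ∣z∣≤N)) (⇔.sym ⊕-flip-⇔)) }

    -- An offset t from p ⊕ z is the offset z + t from p, and ∣ z + t ∣ ≤ N + N ≤ M.
    similar-shift : ∀ {M N p q p' q' z} → Similar L₁ L₂ M p q p' q' → ∣ z ∣ ℕ.≤ N → N ℕ.+ N ℕ.≤ M →
                    Similar L₁ L₂ N (p ⊕ z) q (p' ⊕ z) q'
    similar-shift {M} {N} {p} {q} {p'} {q'} {z} sim ∣z∣≤N N+N≤M = record { order = order′ ; offsets = offsets′ }
      where
      ∣z∣≤M : ∣ z ∣ ℕ.≤ M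
      ∣z∣≤M = ℕ.≤-trans (ℕ.m≤m+n (∣ z ∣) N) (ℕ.≤-trans (ℕ.+-monoˡ-≤ N ∣z∣≤N) N+N≤M)
      order′ : p ⊕ z A.≼ q ⇔ p' ⊕ z B.≼ q'
      order′ with em {Within M p q}
      ... | yes (s , ∣s∣≤M , q≡p⊕s) =
        ⇔.trans (A.≼-offset {p} q≡p⊕s) (⇔.sym (B.≼-offset {p'} (to (offsets sim s ∣s∣≤M) q≡p⊕s)))
      ... | no  far′ =
        ⇔.trans (A.⊕-≼-far far′ ∣z∣≤M) (⇔.trans (order sim) (⇔.sym (B.⊕-≼-far (far sim far′) ∣z∣≤M)))
      offsets′ : ∀ t → ∣ t ∣ ℕ.≤ N → q ≡ p ⊕ z ⊕ t ⇔ q' ≡ p' ⊕ z ⊕ t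
      offsets′ t ∣t∣≤N =
        subst₂ (λ r r' → q ≡ r ⇔ q' ≡ r') (sym (⊕-assoc p z t)) (sym (⊕-assoc p' z t))
          (offsets sim (z + t) (ℕ.≤-trans (ℤ.∣i+j∣≤∣i∣+∣j∣ z t) (ℕ.≤-trans (ℕ.+-mono-≤ ∣z∣≤N ∣t∣≤N) N+N≤M)))

    similar-far : ∀ {N p q p' q'} → (p A.≼ q ⇔ p' B.≼ q') → Far N q p → Far N q' p' → Similar L₁ L₂ N p q p' q'
    similar-far order far far' = record
      { order   = order
      ; offsets = λ z ∣z∣≤N → mk⇔ (λ q≡p⊕z → ⊥-elim (far (within-sym (z , ∣z∣≤N , q≡p⊕z))))
                                   (λ q'≡p'⊕z → ⊥-elim (far' (within-sym (z , ∣z∣≤N , q'≡p'⊕z)))) }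

    similar-extend : ∀ {M N m} {a : Fin m → A.Point} {b : Fin m → B.Point} {x y} →
                     SimilarTuples L₁ L₂ M a b → N ℕ.≤ M → (∀ j → Similar L₁ L₂ N x (a j) y (b j)) →
                     SimilarTuples L₁ L₂ N (a ▸ x) (b ▸ y)
    similar-extend sim N≤M new zero    zero    = similar-refl
    similar-extend sim N≤M new zero    (suc j) = new j
    similar-extend sim N≤M new (suc i) zero    = similar-swap (new i)
    similar-extend sim N≤M new (suc i) (suc j) = similar-mono N≤M (sim i j)

    module _ {N m} {a : Fin m → A.Point} {b : Fin m → B.Point} {x}
             (sim : SimilarTuples L₁ L₂ (ℕ.suc (N ℕ.+ N)) a b) (far : ∀ i → Far N (a i) x) where

      forth-above : ∀ {i} → a i A.≼ x → (∀ j → a j A.≼ x → a j A.≼ a i) →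
                    ∀ j → Similar L₁ L₂ N x (a j) (b i ⊕ + ℕ.suc N) (b j)
      forth-above {i} aᵢ≼x max j with em {a j A.≼ x}
      ... | yes aⱼ≼x =
        let y⋠bⱼ , far′ = B.above-far (to (order (sim j i)) (max j aⱼ≼x))
            x⋠aⱼ x≼aⱼ = far j (0ℤ , ℕ.z≤n , from ≡⊕0⇔≡ (A.≼-antisym x≼aⱼ aⱼ≼x))
        in similar-far (mk⇔ (⊥-elim ∘ x⋠aⱼ) (⊥-elim ∘ y⋠bⱼ)) (far j) far′
      ... | no aⱼ⋠x =
        let x≼aⱼ = A.≰⇒≽ aⱼ⋠x
            y≼bⱼ , far′ = B.between-far (to (order (sim i j)) (A.≼-trans aᵢ≼x x≼aⱼ))
                                        (Similar.far (sim i j) (A.gap aᵢ≼x x≼aⱼ (far i) (far-sym (far j))))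
        in similar-far (mk⇔ (λ _ → y≼bⱼ) (λ _ → x≼aⱼ)) (far j) far′

      forth-below : (∀ i → ¬ a i A.≼ x) → Σ[ y ∈ B.Point ] ∀ j → Similar L₁ L₂ N x (a j) y (b j)
      forth-below none with greatest (Flip.isTotalPreorder B.≼-isTotalPreorder) b {λ _ → ⊤} (λ _ → yes tt)
      ... | inj₁ no-index      = (point L₂ , 0ℤ) , λ j → ⊥-elim (no-index j tt)
      ... | inj₂ (i , _ , min) = b i ⊕ -[1+ N ] , λ j →
        let y≼bⱼ , far′ = B.below-far (min j tt) in
        similar-far (mk⇔ (λ _ → y≼bⱼ) (λ _ → A.≰⇒≽ (none j))) (far j) far′

      forth-far : Σ[ y ∈ B.Point ] ∀ j → Similar L₁ L₂ N x (a j) y (b j)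
      forth-far with greatest A.≼-isTotalPreorder a (λ i → em {a i A.≼ x})
      ... | inj₁ none              = forth-below none
      ... | inj₂ (i , aᵢ≼x , max) = b i ⊕ + ℕ.suc N , forth-above aᵢ≼x max

    forth : ∀ {N m} {a : Fin m → A.Point} {b : Fin m → B.Point} → SimilarTuples L₁ L₂ (ℕ.suc (N ℕ.+ N)) a b →
            ∀ x → Σ[ y ∈ B.Point ] ∀ j → Similar L₁ L₂ N x (a j) y (b j)
    forth {N} {a = a} {b} sim x with em {Σ[ i ∈ _ ] Within N (a i) x}
    ... | yes (i , z , ∣z∣≤N , refl) = b i ⊕ z , λ j → similar-shift (sim i j) ∣z∣≤N (ℕ.n≤1+n _)
    ... | no  ¬near                 = forth-far sim (λ i near → ¬near (i , near))

  back : ∀ L₁ L₂ {N m} {a : Fin m → Carrier (ℤ· L₁)} {b : Fin m → Carrier (ℤ· L₂)} →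
         SimilarTuples L₁ L₂ (ℕ.suc (N ℕ.+ N)) a b →
         ∀ y → Σ[ x ∈ Carrier (ℤ· L₁) ] ∀ j → Similar L₁ L₂ N x (a j) y (b j)
  back L₁ L₂ sim y =
    let x , new = Game.forth L₂ L₁ (λ i j → similar-sym (sim i j)) y in x , λ j → similar-sym (new j)

  similar⇒sat⇔ : ∀ L₁ L₂ n {m} {φ : Formula m} (mf : ModalFree φ) → rank mf ℕ.≤ n →
                 ∀ {a b} → SimilarTuples L₁ L₂ (scale n) a b → Sat (ℤ· L₁) φ a ⇔ Sat (ℤ· L₂) φ b
  similar⇒sat⇔ L₁ L₂ n (mf≤ i j) _ sim = Lift-cong-⇔ (order (sim i j))
  similar⇒sat⇔ L₁ L₂ n (mf≐ i j) _ sim = Lift-cong-⇔ (equal (sim j i))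
  similar⇒sat⇔ L₁ L₂ n mf⊤       _ sim = mk⇔ (λ x → x) (λ x → x)
  similar⇒sat⇔ L₁ L₂ n mf⊥       _ sim = mk⇔ (λ x → x) (λ x → x)
  similar⇒sat⇔ L₁ L₂ n (mf¬ φ)   r sim = ¬-cong-⇔ (similar⇒sat⇔ L₁ L₂ n φ r sim)
  similar⇒sat⇔ L₁ L₂ n (mf∧ φ ψ) r sim =
    similar⇒sat⇔ L₁ L₂ n φ (ℕ.m⊔n≤o⇒m≤o _ _ r) sim ×-⇔ similar⇒sat⇔ L₁ L₂ n ψ (ℕ.m⊔n≤o⇒n≤o _ _ r) sim
  similar⇒sat⇔ L₁ L₂ n (mf∨ φ ψ) r sim =
    similar⇒sat⇔ L₁ L₂ n φ (ℕ.m⊔n≤o⇒m≤o _ _ r) sim ⊎-⇔ similar⇒sat⇔ L₁ L₂ n ψ (ℕ.m⊔n≤o⇒n≤o _ _ r) sim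
  similar⇒sat⇔ L₁ L₂ n (mf⇒ φ ψ) r sim =
    →-cong-⇔ (similar⇒sat⇔ L₁ L₂ n φ (ℕ.m⊔n≤o⇒m≤o _ _ r) sim) (similar⇒sat⇔ L₁ L₂ n ψ (ℕ.m⊔n≤o⇒n≤o _ _ r) sim)
  similar⇒sat⇔ L₁ L₂ (ℕ.suc n) {φ = ∃' φ} (mf∃ mf) (ℕ.s≤s r) {a} {b} sim = mk⇔
    (λ (x , sat) → let y , new = Game.forth L₁ L₂ sim x in y , to (step new) sat)
    (λ (y , sat) → let x , new = back L₁ L₂ sim y in x , from (step new) sat)
    where
    step : ∀ {x y} → (∀ j → Similar L₁ L₂ (scale n) x (a j) y (b j)) →
           Sat (ℤ· L₁) φ (a ▸ x) ⇔ Sat (ℤ· L₂) φ (b ▸ y)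
    step new = similar⇒sat⇔ L₁ L₂ n mf r (Game.similar-extend L₁ L₂ sim (ℕ.m≤n⇒m≤1+n (ℕ.m≤m+n _ _)) new)
  similar⇒sat⇔ L₁ L₂ (ℕ.suc n) {φ = ∀' φ} (mf∀ mf) (ℕ.s≤s r) {a} {b} sim = mk⇔
    (λ sat y → let x , new = back L₁ L₂ sim y in to (step new) (sat x))
    (λ sat x → let y , new = Game.forth L₁ L₂ sim x in from (step new) (sat y))
    where
    step : ∀ {x y} → (∀ j → Similar L₁ L₂ (scale n) x (a j) y (b j)) →
           Sat (ℤ· L₁) φ (a ▸ x) ⇔ Sat (ℤ· L₂) φ (b ▸ y)
    step new = similar⇒sat⇔ L₁ L₂ n mf r (Game.similar-extend L₁ L₂ sim (ℕ.m≤n⇒m≤1+n (ℕ.m≤m+n _ _)) new)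

  ℤ·-elementarilyEquivalent : ∀ L₁ L₂ {φ : Formula 0} → ModalFree φ → ℤ· L₁ ⊨ φ ⇔ ℤ· L₂ ⊨ φ
  ℤ·-elementarilyEquivalent L₁ L₂ mf = similar⇒sat⇔ L₁ L₂ (rank mf) mf ℕ.≤-refl (λ ())

corollary5p3 : ExcludedMiddle (Level.suc Level.zero) →
    ¬ (Σ (Formula 0) (λ φ → ModalFree φ × ((U : LO) → (U ⊨ Scatt) ⇔ (U ⊨ φ))))
corollary5p3 em (φ , mf , Scatt⇔φ) = ℤ·ℚ±-unscattered (from (Scatt⇔φ (ℤ· ℚ±)) ℤ·ℚ±⊨φ)
  where
  open Classical (lower-em em)
  ℤ·ℚ±⊨φ : ℤ· ℚ± ⊨ φ
  ℤ·ℚ±⊨φ = to (ℤ·-elementarilyEquivalent 𝟙 ℚ± mf) (to (Scatt⇔φ (ℤ· 𝟙)) ℤ·𝟙-scattered)
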